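{- A digraph $H$ is a hero in orientations of unit interval graphs if and only if $H$ is a hero in tournaments.
   Context: All digraphs are finite and simple (no loops, no parallel arcs, no digons). A unit interval graph is a graph admitting an interval representation (vertices are intervals of the real line, adjacent iff they intersect) in which every interval has length $1$; an orientation of a unit interval graph is a digraph whose underlying undirected graph is a unit interval graph. A tournament is an orientation of a complete graph. The dichromatic number of a digraph is the least $k$ such that its vertex set can be partitioned into $k$ sets each inducing an acyclic subdigraph. A digraph $H$ is a hero in a hereditary class $\mathcal{C}$ of digraphs if there is a constant $c$ such that every digraph in $\mathcal{C}$ with no induced copy of $H$ has dichromatic number at most $c$.
   Formalization: The intervals in the unit interval representations have rational endpoints instead of real ones. -}

module Defs where

open import Data.Nat using (ℕ; zero; suc)
open import Data.Fin using (Fin; zero; suc; inject₁; fromℕ)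
open import Data.Bool using (Bool; true; false)
open import Data.Product using (Σ; ∃; _×_; _,_)
open import Data.Sum using (_⊎_)
open import Relation.Binary.PropositionalEquality using (_≡_)
open import Relation.Nullary using (¬_)
open import Function.Definitions using (Injective)
import Data.Rational as ℚ
open ℚ using (ℚ; 1ℚ)

record Digraph (n : ℕ) : Set where
  field
    arc      : Fin n → Fin n → Bool
    loopless : ∀ v → arc v v ≡ false
    noDigon  : ∀ u v → arc u v ≡ true → arc v u ≡ false
open Digraph public

Arc : ∀ {n} → Digraph n → Fin n → Fin n → Set
Arc D u v = arc D u v ≡ true

Class : Set₁
Class = ∀ n → Digraph n → Set

InducedCopy : ∀ {h n} → Digraph h → Digraph n → Set
InducedCopy {h} {n} H G =
  Σ (Fin h → Fin n) λ f → Injective _≡_ _≡_ f × (∀ u v → arc G (f u) (f v) ≡ arc H u v)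

HFree : ∀ {h n} → Digraph h → Digraph n → Set
HFree H G = ¬ InducedCopy H G

record CycleIn {n : ℕ} (D : Digraph n) (S : Fin n → Set) : Set where
  field
    k      : ℕ
    c      : Fin (suc k) → Fin n
    inj    : Injective _≡_ _≡_ c
    steps  : ∀ (i : Fin k) → Arc D (c (inject₁ i)) (c (suc i))
    close  : Arc D (c (fromℕ k)) (c zero)
    inside : ∀ i → S (c i)

InducesAcyclic : ∀ {n} → Digraph n → (Fin n → Set) → Set
InducesAcyclic D S = ¬ CycleIn D S

DichromaticAtMost : ∀ {n} → Digraph n → ℕ → Set
DichromaticAtMost {n} D c =
  Σ (Fin n → Fin c) λ col → ∀ (j : Fin c) → InducesAcyclic D (λ v → col v ≡ j)

Hero : Class → ∀ {h} → Digraph h → Set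
Hero 𝒞 H = ∃ λ (c : ℕ) → ∀ n (G : Digraph n) → 𝒞 n G → HFree H G → DichromaticAtMost G c

Tournament : Class
Tournament n D = ∀ (u v : Fin n) → ¬ u ≡ v → Arc D u v ⊎ Arc D v u

UnitIntervalsMeet : ℚ → ℚ → Set
UnitIntervalsMeet a b =
  ∃ λ (t : ℚ) → (a ℚ.≤ t × t ℚ.≤ a ℚ.+ 1ℚ) × (b ℚ.≤ t × t ℚ.≤ b ℚ.+ 1ℚ)

-- Orientation of a unit interval graph: the underlying graph (u ~ v iff an arc
-- in either direction) has a unit interval representation (rational left endpoints).
OrientedUnitInterval : Class
OrientedUnitInterval n D =
  Σ (Fin n → ℚ) λ x → ∀ (u v : Fin n) → ¬ u ≡ v →
    ((Arc D u v ⊎ Arc D v u) → UnitIntervalsMeet (x u) (x v)) ×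
    (UnitIntervalsMeet (x u) (x v) → Arc D u v ⊎ Arc D v u)

{-# OPTIONS --safe #-}
-- Tournaments are orientations of unit interval graphs (give every vertex the same interval), which
-- gives one direction. Conversely, sort the vertices of an oriented unit interval graph into layers
-- by the integer part of their left endpoints: each layer is a tournament, and arcs only join equal
-- or consecutive layers. Colour every layer with c colours and pair each colour with the parity of
-- the layer; a directed cycle in one of the resulting 2c classes can never change layer, so it would
-- be a monochromatic cycle inside a single tournament.
module Submission where

open import Defs

open import Data.Fin using (Fin; zero; suc; inject₁; combine)
open import Data.Fin.Properties using (combine-injective)
open import Data.Integer as ℤ using (ℤ; +_; -[1+_])
import Data.Integer.Properties as ℤ
open import Data.Integer.DivMod using ([n/d]*d≤n; n<s[n/ℕd]*d; div-pos-is-/ℕ)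
open import Data.List.Base using (List; length; lookup; filter; allFin)
open import Data.List.Membership.Propositional using (_∈_)
open import Data.List.Membership.Propositional.Properties using (∈-filter⁺; ∈-filter⁻; ∈-lookup; ∈-allFin)
import Data.List.Relation.Unary.All as All
open import Data.List.Relation.Unary.AllPairs using (_∷_)
import Data.List.Relation.Unary.Any as Any
open import Data.List.Relation.Unary.Any.Properties using (lookup-index)
open import Data.List.Relation.Unary.Unique.Propositional using (Unique)
open import Data.List.Relation.Unary.Unique.Propositional.Properties using (filter⁺; allFin⁺)
open import Data.Nat as ℕ using (ℕ; zero; suc)
open import Data.Parity.Base using (Parity; 0ℙ; 1ℙ; _⁻¹)
open import Data.Parity.Properties using (suc-homo-⁻¹; ⁻¹-selfInverse; p≢p⁻¹)
open import Data.Product using (Σ; ∃; _×_; _,_; proj₁; proj₂)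
open import Data.Rational as ℚ using (1ℚ; toℚᵘ)
import Data.Rational.Properties as ℚ
open import Data.Rational.Unnormalised as ℚᵘ using (mkℚᵘ; *≤*; *<*; *≡*; 1ℚᵘ; _/_)
import Data.Rational.Unnormalised.Properties as ℚᵘ
open import Data.Sum using (inj₁; inj₂)
open import Function using (_∘_)
open import Function.Bundles using (_⇔_; mk⇔)
open import Function.Definitions using (Injective)
open import Level using (0ℓ)
open import Relation.Binary.Definitions using (tri<; tri≈; tri>)
open import Relation.Binary.PropositionalEquality
open import Relation.Nullary using (contradiction)
open import Relation.Unary using (Pred; Decidable)

⌊p⌋/1≤p : ∀ p → ℚᵘ.floor p / 1 ℚᵘ.≤ p
⌊p⌋/1≤p (mkℚᵘ n d) =
  *≤* (ℤ.≤-trans ([n/d]*d≤n n (+ suc d)) (ℤ.≤-reflexive (sym (ℤ.*-identityʳ n))))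

p<suc[⌊p⌋]/1 : ∀ p → p ℚᵘ.< ℤ.suc (ℚᵘ.floor p) / 1
p<suc[⌊p⌋]/1 (mkℚᵘ n d) = *<* (subst₂ ℤ._<_
  (sym (ℤ.*-identityʳ n))
  (cong (λ k → ℤ.suc k ℤ.* + suc d) (sym (div-pos-is-/ℕ n (suc d))))
  (n<s[n/ℕd]*d n (suc d)))

k/1+1≃suc[k]/1 : ∀ k → k / 1 ℚᵘ.+ 1ℚᵘ ℚᵘ.≃ ℤ.suc k / 1
k/1+1≃suc[k]/1 k = *≡* (begin
  (k ℤ.* + 1 ℤ.+ + 1 ℤ.* + 1) ℤ.* + 1 ≡⟨ ℤ.*-identityʳ _ ⟩
  k ℤ.* + 1 ℤ.+ + 1                    ≡⟨ cong (ℤ._+ + 1) (ℤ.*-identityʳ k) ⟩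
  k ℤ.+ + 1                            ≡⟨ ℤ.+-comm k (+ 1) ⟩
  ℤ.suc k                              ≡⟨ ℤ.*-identityʳ _ ⟨
  ℤ.suc k ℤ.* + 1                      ∎)
  where open ≡-Reasoning

k/1<m/1⇒k<m : ∀ {k m} → k / 1 ℚᵘ.< m / 1 → k ℤ.< m
k/1<m/1⇒k<m {k} {m} (*<* k<m) = subst₂ ℤ._<_ (ℤ.*-identityʳ k) (ℤ.*-identityʳ m) k<m

i<suc[j]⇒i≤j : ∀ {i j} → i ℤ.< ℤ.suc j → i ℤ.≤ j
i<suc[j]⇒i≤j {j = j} i<sj = subst (_ ℤ.≤_) (ℤ.pred-suc j) (ℤ.i<j⇒i≤pred[j] i<sj)

-- Matching on the record constructor makes ℚ.floor a reduce to ℚᵘ.floor (toℚᵘ a).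
⌊a⌋≡⌊b⌋⇒b≤a+1 : ∀ a b → ℚ.floor a ≡ ℚ.floor b → b ℚ.≤ a ℚ.+ 1ℚ
⌊a⌋≡⌊b⌋⇒b≤a+1 a@record{} b@record{} ⌊a⌋≡⌊b⌋ = ℚ.toℚᵘ-cancel-≤ (begin
  toℚᵘ b                 <⟨ p<suc[⌊p⌋]/1 (toℚᵘ b) ⟩
  ℤ.suc (ℚ.floor b) / 1  ≡⟨ cong (λ k → ℤ.suc k / 1) (sym ⌊a⌋≡⌊b⌋) ⟩
  ℤ.suc (ℚ.floor a) / 1  ≃⟨ k/1+1≃suc[k]/1 (ℚ.floor a) ⟨
  ℚ.floor a / 1 ℚᵘ.+ 1ℚᵘ ≤⟨ ℚᵘ.+-monoˡ-≤ 1ℚᵘ (⌊p⌋/1≤p (toℚᵘ a)) ⟩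
  toℚᵘ a ℚᵘ.+ 1ℚᵘ        ≃⟨ ℚ.toℚᵘ-homo-+ a 1ℚ ⟨
  toℚᵘ (a ℚ.+ 1ℚ)        ∎)
  where open ℚᵘ.≤-Reasoning

meet-sym : ∀ {a b} → UnitIntervalsMeet a b → UnitIntervalsMeet b a
meet-sym (t , a∋t , b∋t) = t , b∋t , a∋t

floor-≡⇒meet : ∀ {a b} → ℚ.floor a ≡ ℚ.floor b → UnitIntervalsMeet a b
floor-≡⇒meet {a} {b} ⌊a⌋≡⌊b⌋ with ℚ.≤-total a b
... | inj₁ a≤b = b , (a≤b , ⌊a⌋≡⌊b⌋⇒b≤a+1 a b ⌊a⌋≡⌊b⌋) , (ℚ.≤-refl , ⌊a⌋≡⌊b⌋⇒b≤a+1 b b refl)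
... | inj₂ b≤a = a , (ℚ.≤-refl , ⌊a⌋≡⌊b⌋⇒b≤a+1 a a refl) , (b≤a , ⌊a⌋≡⌊b⌋⇒b≤a+1 b a (sym ⌊a⌋≡⌊b⌋))

meet⇒⌊a⌋≤suc⌊b⌋ : ∀ {a b} → UnitIntervalsMeet a b → ℚ.floor a ℤ.≤ ℤ.suc (ℚ.floor b)
meet⇒⌊a⌋≤suc⌊b⌋ {a@record{}} {b@record{}} (t , (a≤t , _) , (_ , t≤b+1)) =
  i<suc[j]⇒i≤j (k/1<m/1⇒k<m (begin-strict
    ℚ.floor a / 1                  ≤⟨ ⌊p⌋/1≤p (toℚᵘ a) ⟩
    toℚᵘ a                         ≤⟨ ℚ.toℚᵘ-mono-≤ (ℚ.≤-trans a≤t t≤b+1) ⟩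
    toℚᵘ (b ℚ.+ 1ℚ)                ≃⟨ ℚ.toℚᵘ-homo-+ b 1ℚ ⟩
    toℚᵘ b ℚᵘ.+ 1ℚᵘ                <⟨ ℚᵘ.+-monoˡ-< 1ℚᵘ (p<suc[⌊p⌋]/1 (toℚᵘ b)) ⟩
    ℤ.suc (ℚ.floor b) / 1 ℚᵘ.+ 1ℚᵘ ≃⟨ k/1+1≃suc[k]/1 (ℤ.suc (ℚ.floor b)) ⟩
    ℤ.suc (ℤ.suc (ℚ.floor b)) / 1  ∎))
  where open ℚᵘ.≤-Reasoning

parityℤ : ℤ → Parity
parityℤ k = ℕ.parity ℤ.∣ k ∣

parityℤ-suc : ∀ k → parityℤ (ℤ.suc k) ≡ parityℤ k ⁻¹
parityℤ-suc (+ n)        = sym (⁻¹-selfInverse (suc-homo-⁻¹ n))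
parityℤ-suc -[1+ zero ]  = refl
parityℤ-suc -[1+ suc n ] = sym (⁻¹-selfInverse (suc-homo-⁻¹ n))

parityℤ-≢-suc : ∀ i → parityℤ i ≢ parityℤ (ℤ.suc i)
parityℤ-≢-suc i eq = p≢p⁻¹ (parityℤ i) (trans eq (parityℤ-suc i))

near∧parityℤ-≡⇒≡ : ∀ {i j} → i ℤ.≤ ℤ.suc j → j ℤ.≤ ℤ.suc i → parityℤ i ≡ parityℤ j → i ≡ j
near∧parityℤ-≡⇒≡ {i} {j} i≤sj j≤si eq with ℤ.<-cmp i j
... | tri< i<j _ _ = contradiction (trans eq (cong parityℤ (ℤ.≤-antisym j≤si (ℤ.i<j⇒suc[i]≤j i<j))))
                                   (parityℤ-≢-suc i)
... | tri≈ _ i≡j _ = i≡j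
... | tri> _ _ j<i = contradiction (trans (sym eq) (cong parityℤ (ℤ.≤-antisym i≤sj (ℤ.i<j⇒suc[i]≤j j<i))))
                                   (parityℤ-≢-suc j)

toFin : Parity → Fin 2
toFin 0ℙ = zero
toFin 1ℙ = suc zero

toFin-injective : ∀ {p q} → toFin p ≡ toFin q → p ≡ q
toFin-injective {0ℙ} {0ℙ} _ = refl
toFin-injective {1ℙ} {1ℙ} _ = refl

induced : ∀ {m n} → Digraph n → (Fin m → Fin n) → Digraph m
induced D e = record
  { arc      = λ i j → arc D (e i) (e j)
  ; loopless = λ i → loopless D (e i)
  ; noDigon  = λ i j → noDigon D (e i) (e j)
  }

HFree-induced : ∀ {h m n} (H : Digraph h) (G : Digraph n) {e : Fin m → Fin n} →
                Injective _≡_ _≡_ e → HFree H G → HFree H (induced G e)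
HFree-induced H G {e} e-inj H-free (f , f-inj , f-arc) = H-free (e ∘ f , f-inj ∘ e-inj , f-arc)

inducesAcyclic-induced : ∀ {m n} (D : Digraph n) (e : Fin m → Fin n) {S : Fin m → Set} {T : Fin n → Set} →
                         InducesAcyclic (induced D e) S → (∀ {v} → T v → ∃ λ i → e i ≡ v × S i) →
                         InducesAcyclic D T
inducesAcyclic-induced D e acyclic lift C = acyclic record
  { k      = C.k
  ; c      = c
  ; inj    = λ {i} {j} cᵢ≡cⱼ → C.inj (trans (sym (e∘c i)) (trans (cong e cᵢ≡cⱼ) (e∘c j)))
  ; steps  = λ i → subst₂ (Arc D) (sym (e∘c (inject₁ i))) (sym (e∘c (suc i))) (C.steps i)
  ; close  = subst₂ (Arc D) (sym (e∘c _)) (sym (e∘c zero)) C.close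
  ; inside = λ i → proj₂ (proj₂ (lift (C.inside i)))
  }
  where
  module C = CycleIn C
  c : Fin (suc C.k) → _
  c i = proj₁ (lift (C.inside i))
  e∘c : ∀ i → e (c i) ≡ C.c i
  e∘c i = proj₁ (proj₂ (lift (C.inside i)))

arc⇒≢ : ∀ {n} (D : Digraph n) {u v} → Arc D u v → u ≢ v
arc⇒≢ D {u} uv refl with () ← trans (sym uv) (loopless D u)

path-constant : ∀ {A : Set} {k} (g : Fin (suc k) → A) → (∀ i → g (inject₁ i) ≡ g (suc i)) →
                ∀ i → g i ≡ g zero
path-constant             g step zero    = refl
path-constant {k = suc k} g step (suc i) = trans (path-constant (g ∘ suc) (step ∘ suc) i) (sym (step zero))

layered-dichromatic : ∀ {n c} (D : Digraph n) (ℓ : Fin n → ℤ) →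
                      (∀ {u v} → Arc D u v → ℓ u ℤ.≤ ℤ.suc (ℓ v) × ℓ v ℤ.≤ ℤ.suc (ℓ u)) →
                      (col : Fin n → Fin c) → (∀ b j → InducesAcyclic D (λ v → ℓ v ≡ b × col v ≡ j)) →
                      DichromaticAtMost D (2 ℕ.* c)
layered-dichromatic {n} {c} D ℓ near col acyclic = colour , colour-acyclic
  where
  colour : Fin n → Fin (2 ℕ.* c)
  colour v = combine (toFin (parityℤ (ℓ v))) (col v)

  same-colour : ∀ {u v} → colour u ≡ colour v → parityℤ (ℓ u) ≡ parityℤ (ℓ v) × col u ≡ col v
  same-colour eq with combine-injective _ _ _ _ eq
  ... | p , q = toFin-injective p , q

  colour-acyclic : ∀ j → InducesAcyclic D (λ v → colour v ≡ j)
  colour-acyclic j C = acyclic (ℓ (C.c zero)) (col (C.c zero)) record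
    { k = C.k ; c = C.c ; inj = C.inj ; steps = C.steps ; close = C.close
    ; inside = λ i → same-layer i , proj₂ (same-colour (trans (C.inside i) (sym (C.inside zero))))
    }
    where
    module C = CycleIn C
    same-layer : ∀ i → ℓ (C.c i) ≡ ℓ (C.c zero)
    same-layer = path-constant (ℓ ∘ C.c) λ i →
      let (ℓu≤ , ℓv≤) = near (C.steps i)
      in near∧parityℤ-≡⇒≡ ℓu≤ ℓv≤ (proj₁ (same-colour (trans (C.inside (inject₁ i)) (sym (C.inside (suc i))))))

lookup-injective : ∀ {A : Set} {xs : List A} → Unique xs → Injective _≡_ _≡_ (lookup xs)
lookup-injective (_  ∷ _)   {zero}  {zero}  _  = refl
lookup-injective (x∉ ∷ _)   {zero}  {suc j} eq = contradiction eq (All.lookup x∉ (∈-lookup j))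
lookup-injective (x∉ ∷ _)   {suc i} {zero}  eq = contradiction (sym eq) (All.lookup x∉ (∈-lookup i))
lookup-injective (_  ∷ xs!) {suc i} {suc j} eq = cong suc (lookup-injective xs! eq)

record Enumeration {n} (P : Pred (Fin n) 0ℓ) : Set where
  field
    size              : ℕ
    element           : Fin size → Fin n
    element-injective : Injective _≡_ _≡_ element
    element-satisfies : ∀ i → P (element i)
    index             : ∀ {v} → P v → Fin size
    element-index     : ∀ {v} (p : P v) → element (index p) ≡ v

enumerate : ∀ {n} {P : Pred (Fin n) 0ℓ} → Decidable P → Enumeration P
enumerate {n} {P} P? = record
  { size              = length xs
  ; element           = lookup xs
  ; element-injective = lookup-injective (filter⁺ P? (allFin⁺ n))
  ; element-satisfies = λ i → proj₂ (∈-filter⁻ P? {xs = allFin n} (∈-lookup i))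
  ; index             = λ p → Any.index (∈xs p)
  ; element-index     = λ p → sym (lookup-index (∈xs p))
  }
  where
  xs = filter P? (allFin n)
  ∈xs : ∀ {v} → P v → v ∈ xs
  ∈xs {v} p = ∈-filter⁺ P? (∈-allFin v) p

module _ {n} (G : Digraph n) (ℓ : Fin n → ℤ) where

  layer : (b : ℤ) → Enumeration (λ v → ℓ v ≡ b)
  layer b = enumerate (λ v → ℓ v ℤ.≟ b)

  layer-digraph : (b : ℤ) → Digraph (Enumeration.size (layer b))
  layer-digraph b = induced G (Enumeration.element (layer b))

  layerwise-colouring : ∀ {c} → (∀ b → DichromaticAtMost (layer-digraph b) c) →
                        Σ (Fin n → Fin c) λ col → ∀ b j → InducesAcyclic G (λ v → ℓ v ≡ b × col v ≡ j)
  layerwise-colouring {c} χ = col , λ b j →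
    let open Enumeration (layer b)
    in inducesAcyclic-induced G element (proj₂ (χ b) j)
         λ (ℓv≡b , colv≡j) → index ℓv≡b , element-index ℓv≡b , trans (col-index ℓv≡b) colv≡j
    where
    col : Fin n → Fin c
    col v = proj₁ (χ (ℓ v)) (Enumeration.index (layer (ℓ v)) refl)
    col-index : ∀ {v b} (ℓv≡b : ℓ v ≡ b) → proj₁ (χ b) (Enumeration.index (layer b) ℓv≡b) ≡ col v
    col-index refl = refl

orientedUnitInterval-dichromatic :
  ∀ {n c} (G : Digraph n) → OrientedUnitInterval n G →
  (∀ {m} (e : Fin m → Fin n) → Injective _≡_ _≡_ e → Tournament m (induced G e) →
   DichromaticAtMost (induced G e) c) →
  DichromaticAtMost G (2 ℕ.* c)
orientedUnitInterval-dichromatic G (x , rep) χ =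
  let (col , acyclic) = layerwise-colouring G ℓ λ b →
                          χ _ (Enumeration.element-injective (layer G ℓ b)) (layer-tournament b)
  in layered-dichromatic G ℓ near col acyclic
  where
  ℓ : Fin _ → ℤ
  ℓ v = ℚ.floor (x v)

  near : ∀ {u v} → Arc G u v → ℓ u ℤ.≤ ℤ.suc (ℓ v) × ℓ v ℤ.≤ ℤ.suc (ℓ u)
  near {u} {v} uv = let meet = proj₁ (rep u v (arc⇒≢ G uv)) (inj₁ uv)
                    in meet⇒⌊a⌋≤suc⌊b⌋ meet , meet⇒⌊a⌋≤suc⌊b⌋ (meet-sym meet)

  layer-tournament : ∀ b → Tournament _ (layer-digraph G ℓ b)
  layer-tournament b i j i≢j = proj₂ (rep (element i) (element j) (i≢j ∘ element-injective))
                                 (floor-≡⇒meet (trans (element-satisfies i) (sym (element-satisfies j))))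
    where open Enumeration (layer G ℓ b)

hero-in-tournaments⇒hero-in-orientedUnitInterval :
  ∀ {h} (H : Digraph h) → Hero Tournament H → Hero OrientedUnitInterval H
hero-in-tournaments⇒hero-in-orientedUnitInterval H (c , hero) = 2 ℕ.* c , λ n G oui H-free →
  orientedUnitInterval-dichromatic {c = c} G oui λ e e-inj tournament →
    hero _ (induced G e) tournament (HFree-induced H G e-inj H-free)

tournament⇒orientedUnitInterval : ∀ n (D : Digraph n) → Tournament n D → OrientedUnitInterval n D
tournament⇒orientedUnitInterval _ _ tournament =
  (λ _ → ℚ.0ℚ) , λ u v u≢v → (λ _ → floor-≡⇒meet refl) , (λ _ → tournament u v u≢v)

Hero-antitone : ∀ {𝒞 𝒟 : Class} → (∀ n (D : Digraph n) → 𝒞 n D → 𝒟 n D) →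
                ∀ {h} (H : Digraph h) → Hero 𝒟 H → Hero 𝒞 H
Hero-antitone 𝒞⊆𝒟 H (c , hero) = c , λ n G G∈𝒞 → hero n G (𝒞⊆𝒟 n G G∈𝒞)

theorem3p1 : ∀ (h : ℕ) (H : Digraph h) → Hero OrientedUnitInterval H ⇔ Hero Tournament H
theorem3p1 h H = mk⇔ (Hero-antitone tournament⇒orientedUnitInterval H)
                     (hero-in-tournaments⇒hero-in-orientedUnitInterval H)
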